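{- Let $G$ be a connected graph. If $\mathcal{C}_G$ has exactly two equivalence classes $S_e$ and $S_f$, then either $V(S_e)\subsetneq V(S_f)$ or $V(S_f)\subsetneq V(S_e)$.
   Context: A quasi-transitive $2$-edge-colouring of a graph $G$ is a map $c: E(G)\to\{R,B\}$ such that for all pairs of edges $xy, yz \in E(G)$ with $c(xy)\neq c(yz)$, we have $xz\in E(G)$. $\mathcal{C}_G$ is the equivalence relation on $E(G)$ with $e\sim f$ iff $c(e)=c(f)$ for every quasi-transitive $2$-edge-colouring $c$ of $G$. For a set of edges $E$, $V(E)$ denotes the set of endpoints of edges in $E$. -}

module Defs where

open import Data.Nat using (ℕ; suc)
open import Data.Fin using (Fin)
open import Data.Bool using (Bool; true; false)
open import Data.Product using (Σ; ∃; _×_; _,_; proj₁; proj₂)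
open import Data.Sum using (_⊎_)
open import Relation.Binary.PropositionalEquality using (_≡_; _≢_)
open import Relation.Nullary using (¬_)

record Graph : Set where
  field
    n     : ℕ
    adj   : Fin n → Fin n → Bool
    sym   : ∀ x y → adj x y ≡ adj y x
    irrefl : ∀ x → adj x x ≡ false

module _ (G : Graph) where
  open Graph G

  Adj : Fin n → Fin n → Set
  Adj x y = adj x y ≡ true

  data Walk : Fin n → Fin n → Set where
    here : ∀ {x} → Walk x x
    step : ∀ {x y z} → Adj x y → Walk y z → Walk x z

  Connected : Set
  Connected = ∀ x y → Walk x y

  -- an edge, represented by an ordered pair of adjacent vertices;
  -- (x , y) and (y , x) denote the same edge xy
  Edge : Set
  Edge = Σ (Fin n × Fin n) λ p → Adj (proj₁ p) (proj₂ p)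

  data Colour : Set where
    R B : Colour

  -- a 2-edge-colouring: a colour for each (ordered) adjacent pair, symmetric,
  -- so it is a map on unordered edges
  record Colouring : Set where
    field
      col    : Fin n → Fin n → Colour
      col-sym : ∀ x y → Adj x y → col x y ≡ col y x

  QuasiTransitive : Colouring → Set
  QuasiTransitive c = ∀ x y z → Adj x y → Adj y z →
    Colouring.col c x y ≢ Colouring.col c y z → Adj x z

  _∼_ : Edge → Edge → Set
  ((x , y) , _) ∼ ((u , v) , _) =
    ∀ (c : Colouring) → QuasiTransitive c → Colouring.col c x y ≡ Colouring.col c u v

  ExactlyTwoClasses : Edge → Edge → Set
  ExactlyTwoClasses e f = ¬ (e ∼ f) × (∀ g → (g ∼ e) ⊎ (g ∼ f))

  InV : Edge → Fin n → Set
  InV e v = Σ Edge λ g → (g ∼ e) × ((proj₁ (proj₁ g) ≡ v) ⊎ (proj₂ (proj₁ g) ≡ v))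

  StrictSub : Edge → Edge → Set
  StrictSub e f = (∀ v → InV e v → InV f v) × ∃ λ v → InV f v × ¬ InV e v

module Submission where

-- Two edges forming an induced path (xy, yz with xz a non-edge) get the same colour in every
-- quasi-transitive colouring.  Hence any set of edges that is closed under extension along induced
-- paths is a union of 𝒞_G-classes: colouring it red and the rest blue is quasi-transitive.
--
-- Connectivity gives a vertex y with an S_e-edge yx and an S_f-edge yz; xz must be an edge, say in
-- S_f.  Then z is an apex over the S_e-edge yx: both yz and xz lie in S_f.  Being an S_e-edge with
-- an apex z is closed under extension along induced paths, so every S_e-edge has apex z.  Thus every
-- vertex of V(S_e) is joined to z by an S_f-edge, while z ∉ V(S_e), so V(S_e) ⊊ V(S_f).

open import Defs
open import Data.Bool using (true) renaming (_≟_ to _≟ᵇ_)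
open import Data.Empty using (⊥-elim)
open import Data.Fin using (Fin)
open import Data.Product using (∃-syntax; _×_; _,_; proj₁; proj₂)
open import Data.Sum using (_⊎_; inj₁; inj₂; swap)
open import Relation.Binary.PropositionalEquality using (_≡_; refl; sym; trans; subst)
open import Relation.Nullary using (¬_; Dec; yes; no; contradiction)
open import Relation.Nullary.Decidable using (_×-dec_; decidable-stable)

module ColourForcing (G : Graph) where
  open Graph G using (n; adj; irrefl) renaming (sym to adj-sym)
  open Colouring using (col; col-sym)

  private
    variable
      a b c x y z u v : Fin n

  Adj-sym : Adj G x y → Adj G y x
  Adj-sym {x} {y} xy = trans (adj-sym y x) xy

  Adj-irrefl : ¬ Adj G x x
  Adj-irrefl {x} xx with trans (sym (irrefl x)) xx
  ... | ()

  adj? : ∀ x y → Dec (Adj G x y)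
  adj? x y = adj x y ≟ᵇ true

  _≟ᶜ_ : (r s : Colour G) → Dec (r ≡ s)
  R ≟ᶜ R = yes refl
  B ≟ᶜ B = yes refl
  R ≟ᶜ B = no λ ()
  B ≟ᶜ R = no λ ()

  -- 𝒞_G on ordered pairs of vertices; e ∼ f unfolds to proj₁ e ≈ proj₁ f.
  _≈_ : Fin n × Fin n → Fin n × Fin n → Set
  (x , y) ≈ (u , v) = ∀ c → QuasiTransitive G c → col c x y ≡ col c u v

  ≈-refl : ∀ {p} → p ≈ p
  ≈-refl c qt = refl

  ≈-sym : ∀ {p q} → p ≈ q → q ≈ p
  ≈-sym p≈q c qt = sym (p≈q c qt)

  ≈-trans : ∀ {p q r} → p ≈ q → q ≈ r → p ≈ r
  ≈-trans p≈q q≈r c qt = trans (p≈q c qt) (q≈r c qt)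

  ≈-swap : Adj G x y → (x , y) ≈ (y , x)
  ≈-swap {x} {y} xy c qt = col-sym c x y xy

  induced-path-≈ : Adj G x y → Adj G y z → ¬ Adj G x z → (x , y) ≈ (y , z)
  induced-path-≈ {x} {y} {z} xy yz ¬xz c qt =
    decidable-stable (col c x y ≟ᶜ col c y z) λ xy≢yz → ¬xz (qt x y z xy yz xy≢yz)

  record PathClosed (P : Fin n → Fin n → Set) : Set where
    field
      P?     : ∀ x y → Dec (P x y)
      P-sym  : P x y → P y x
      extend : P x y → Adj G y z → ¬ Adj G x z → P y z

  module _ {P : Fin n → Fin n → Set} (closed : PathClosed P) where
    open PathClosed closed

    indicator : Colouring G
    indicator = record { col = colour ; col-sym = colour-sym }
      where
      colour : Fin n → Fin n → Colour G
      colour x y with P? x y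
      ... | yes _ = R
      ... | no  _ = B

      colour-sym : ∀ x y → Adj G x y → colour x y ≡ colour y x
      colour-sym x y _ with P? x y | P? y x
      ... | yes _  | yes _  = refl
      ... | no  _  | no  _  = refl
      ... | yes xy | no ¬yx = contradiction (P-sym xy) ¬yx
      ... | no ¬xy | yes yx = contradiction (P-sym yx) ¬xy

    indicator-red : P x y → col indicator x y ≡ R
    indicator-red {x} {y} p with P? x y
    ... | yes _ = refl
    ... | no ¬p = contradiction p ¬p

    indicator-blue : ¬ P x y → col indicator x y ≡ B
    indicator-blue {x} {y} ¬p with P? x y
    ... | yes p = contradiction p ¬p
    ... | no  _ = refl

    indicator-quasiTransitive : QuasiTransitive G indicator
    indicator-quasiTransitive x y z xy yz xy≢yz with adj? x z
    ... | yes xz  = xz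
    ... | no ¬xz with P? x y | P? y z
    ...   | yes _   | yes _   = contradiction refl xy≢yz
    ...   | no  _   | no  _   = contradiction refl xy≢yz
    ...   | yes Pxy | no ¬Pyz = contradiction (extend Pxy yz ¬xz) ¬Pyz
    ...   | no ¬Pxy | yes Pyz =
      contradiction (P-sym (extend (P-sym Pyz) (Adj-sym xy) (λ zx → ¬xz (Adj-sym zx)))) ¬Pxy

    PathClosed-respects-≈ : P x y → (x , y) ≈ (u , v) → P u v
    PathClosed-respects-≈ {x} {y} {u} {v} Pxy xy≈uv with P? u v
    ... | yes Puv = Puv
    ... | no ¬Puv with trans (sym (indicator-red Pxy))
                             (trans (xy≈uv indicator indicator-quasiTransitive) (indicator-blue ¬Puv))
    ...   | ()

  ClassEdge : Fin n × Fin n → Fin n → Fin n → Set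
  ClassEdge p x y = Adj G x y × (x , y) ≈ p

  ClassEdge-sym : ∀ {p} → ClassEdge p x y → ClassEdge p y x
  ClassEdge-sym (xy , xy≈p) = Adj-sym xy , ≈-trans (≈-sym (≈-swap xy)) xy≈p

  Incident : Fin n × Fin n → Fin n → Set
  Incident p y = ∃[ x ] ClassEdge p y x

  ExactlyTwoClasses-swap : ∀ {e f} → ExactlyTwoClasses G e f → ExactlyTwoClasses G f e
  ExactlyTwoClasses-swap (e≁f , two) = (λ f∼e → e≁f (≈-sym f∼e)) , λ g → swap (two g)

  module TwoClasses (e f : Edge G) (two : ExactlyTwoClasses G e f) where
    E F : Fin n → Fin n → Set
    E = ClassEdge (proj₁ e)
    F = ClassEdge (proj₁ f)

    ≈e⇒≉f : (x , y) ≈ proj₁ e → ¬ (x , y) ≈ proj₁ f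
    ≈e⇒≉f xy≈e xy≈f = proj₁ two (≈-trans (≈-sym xy≈e) xy≈f)

    classify : Adj G x y → (x , y) ≈ proj₁ e ⊎ (x , y) ≈ proj₁ f
    classify {x} {y} xy = proj₂ two ((x , y) , xy)

    E? : ∀ x y → Dec (E x y)
    E? x y with adj? x y
    ... | no ¬xy = no λ (xy , _) → ¬xy xy
    ... | yes xy with classify xy
    ...   | inj₁ xy≈e = yes (xy , xy≈e)
    ...   | inj₂ xy≈f = no λ (_ , xy≈e) → ≈e⇒≉f xy≈e xy≈f

    F? : ∀ x y → Dec (F x y)
    F? x y with adj? x y
    ... | no ¬xy = no λ (xy , _) → ¬xy xy
    ... | yes xy with classify xy
    ...   | inj₂ xy≈f = yes (xy , xy≈f)
    ...   | inj₁ xy≈e = no λ (_ , xy≈f) → ≈e⇒≉f xy≈e xy≈f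

    Apex : Fin n → Fin n → Fin n → Set
    Apex a x y = E x y × F a x × F a y

    Apex-extend : Apex a x y → Adj G y z → ¬ Adj G x z → Apex a y z
    Apex-extend {a} {x} {y} {z} ((xy , xy≈e) , (ax , ax≈f) , (ay , ay≈f)) yz ¬xz =
      (yz , yz≈e) , (ay , ay≈f) , (az , az≈f)
      where
      yz≈e : (y , z) ≈ proj₁ e
      yz≈e = ≈-trans (≈-sym (induced-path-≈ xy yz ¬xz)) xy≈e

      az : Adj G a z
      az with adj? a z
      ... | yes az  = az
      ... | no ¬az = ⊥-elim (≈e⇒≉f yz≈e (≈-trans (≈-sym (induced-path-≈ ay yz ¬az)) ay≈f))

      az≈f : (a , z) ≈ proj₁ f
      az≈f with classify az
      ... | inj₂ az≈f = az≈f
      ... | inj₁ az≈e = ⊥-elim (≈e⇒≉f az≈e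
        (≈-trans (≈-sym (induced-path-≈ (Adj-sym ax) az ¬xz))
                 (≈-trans (≈-swap (Adj-sym ax)) ax≈f)))

    Apex-pathClosed : PathClosed (Apex a)
    Apex-pathClosed {a} = record
      { P?     = λ x y → E? x y ×-dec (F? a x ×-dec F? a y)
      ; P-sym  = λ (xy , ax , ay) → ClassEdge-sym xy , ay , ax
      ; extend = Apex-extend
      }

    Apex-spread : Apex a b c → E x y → Apex a x y
    Apex-spread apex (xy , xy≈e) =
      PathClosed-respects-≈ Apex-pathClosed apex (≈-trans (proj₂ (proj₁ apex)) (≈-sym xy≈e))

    Apex⇒StrictSub : Apex a b c → StrictSub G e f
    Apex⇒StrictSub {a} {b} apex@(_ , (ab , ab≈f) , _) = V[e]⊆V[f] , a , a∈V[f] , a∉V[e]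
      where
      V[e]⊆V[f] : ∀ v → InV G e v → InV G f v
      V[e]⊆V[f] v (((x , y) , xy) , xy≈e , x≡v⊎y≡v) with Apex-spread apex (xy , xy≈e) | x≡v⊎y≡v
      ... | _ , (ax , ax≈f) , _ | inj₁ x≡v = ((a , x) , ax) , ax≈f , inj₂ x≡v
      ... | _ , _ , (ay , ay≈f) | inj₂ y≡v = ((a , y) , ay) , ay≈f , inj₂ y≡v

      a∈V[f] : InV G f a
      a∈V[f] = ((a , b) , ab) , ab≈f , inj₁ refl

      a∉V[e] : ¬ InV G e a
      a∉V[e] (((x , y) , xy) , xy≈e , x≡a⊎y≡a) with Apex-spread apex (xy , xy≈e) | x≡a⊎y≡a
      ... | _ , (ax , _) , _ | inj₁ x≡a = Adj-irrefl (subst (Adj G a) x≡a ax)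
      ... | _ , _ , (ay , _) | inj₂ y≡a = Adj-irrefl (subst (Adj G a) y≡a ay)

    mixed-vertex : Walk G x z → Incident (proj₁ e) x → Incident (proj₁ f) z →
                   ∃[ y ] Incident (proj₁ e) y × Incident (proj₁ f) y
    mixed-vertex {x} here xe xf = x , xe , xf
    mixed-vertex {x} (step {y = y} xy w) xe zf with classify xy
    ... | inj₂ xy≈f = x , xe , y , xy , xy≈f
    ... | inj₁ xy≈e = mixed-vertex w (x , ClassEdge-sym (xy , xy≈e)) zf

  mixed-vertex⇒StrictSub : ∀ {e f y} → (two : ExactlyTwoClasses G e f) →
    Incident (proj₁ e) y → Incident (proj₁ f) y → StrictSub G e f ⊎ StrictSub G f e
  mixed-vertex⇒StrictSub {e} {f} {y} two (x , yx , yx≈e) (z , yz , yz≈f) with adj? x z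
  ... | no ¬xz = ⊥-elim (≈e⇒≉f (≈-trans (≈-sym (≈-swap yx)) yx≈e)
                          (≈-trans (induced-path-≈ (Adj-sym yx) yz ¬xz) yz≈f))
    where open TwoClasses e f two
  ... | yes xz with TwoClasses.classify e f two xz
  ...   | inj₂ xz≈f = inj₁ (TwoClasses.Apex⇒StrictSub e f two {z} {y} {x}
          ((yx , yx≈e) , ClassEdge-sym (yz , yz≈f) , ClassEdge-sym (xz , xz≈f)))
  ...   | inj₁ xz≈e = inj₂ (TwoClasses.Apex⇒StrictSub f e (ExactlyTwoClasses-swap {e} {f} two) {x} {y} {z}
          ((yz , yz≈f) , ClassEdge-sym (yx , yx≈e) , (xz , xz≈e)))

corollary13 : (G : Graph) → Connected G → (e f : Edge G) →
              ExactlyTwoClasses G e f →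
              StrictSub G e f ⊎ StrictSub G f e
corollary13 G connected e@((e₁ , e₂) , e₁e₂) f@((f₁ , f₂) , f₁f₂) two =
  let y , y-meets-e , y-meets-f =
        mixed-vertex (connected e₁ f₁) (e₂ , e₁e₂ , ≈-refl) (f₂ , f₁f₂ , ≈-refl)
  in  mixed-vertex⇒StrictSub {e} {f} two y-meets-e y-meets-f
  where
  open ColourForcing G
  open TwoClasses e f two using (mixed-vertex)
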